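{- Let $\vec\alpha\,F$ be an $n$-ary BNF and $\sim$ a type-polymorphic family of equivalence relations on $\vec\alpha\,F$ such that $x\sim y$ implies $\mathrm{map}_F\,\vec f\,x\sim\mathrm{map}_F\,\vec f\,y$ for all $\vec f$. Suppose there is a type-polymorphic family of confluent relations $\rightsquigarrow$ on $\vec\alpha\,F$ such that (i) ${\sim}\subseteq{\overset{*}{\leftrightsquigarrow}}$, where $\overset{*}{\leftrightsquigarrow}$ is the equivalence closure of $\rightsquigarrow$; and (ii) whenever $\mathrm{map}_F\,\overrightarrow{\mathrm{fst}}\,x\rightsquigarrow y$, there exists $y'$ with $y=\mathrm{map}_F\,\overrightarrow{\mathrm{fst}}\,y'$, $x\sim y'$, and $\mathrm{set}_{F,i}\,y'\subseteq\mathrm{set}_{F,i}\,x$ for all $i$; and similarly with $\mathrm{snd}$ in place of $\mathrm{fst}$. Then for all relations $\vec R,\vec S$ with $R_i\bullet S_i\neq\emptyset$ for all $i$, $$\mathrm{rel}_F\,\vec R\bullet{\sim}\bullet\mathrm{rel}_F\,\vec S\subseteq{\sim}\bullet\mathrm{rel}_F\,\overrightarrow{(R\bullet S)}\bullet{\sim}.$$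
   Context: HOL setting (all types non-empty); vector notation $\vec x=x_1,\dots,x_n$ with synchronized indices. Relations are identified with sets of pairs and $\bullet$ is relation composition. An $n$-ary BNF is a type constructor $\vec\alpha\,F$ with polymorphic mapper $\mathrm{map}_F::(\alpha_1\to\beta_1)\to\cdots\to(\alpha_n\to\beta_n)\to\vec\alpha\,F\to\vec\beta\,F$, setters $\mathrm{set}_{F,i}::\vec\alpha\,F\to\alpha_i\ \mathrm{set}$, infinite cardinal bound $\mathrm{bd}_F$, relator $\mathrm{rel}_F$, satisfying: $\mathrm{map}_F\,\vec{\mathrm{id}}=\mathrm{id}$; $\mathrm{map}_F\,\vec g\circ\mathrm{map}_F\,\vec f=\mathrm{map}_F\,\overrightarrow{(g\circ f)}$; $\mathrm{set}_{F,i}(\mathrm{map}_F\,\vec f\,x)=f_i\langle\mathrm{set}_{F,i}\,x\rangle$; if $f_i z=g_i z$ for all $i$ and $z\in\mathrm{set}_{F,i}\,x$ then $\mathrm{map}_F\,\vec f\,x=\mathrm{map}_F\,\vec g\,x$; $|\mathrm{set}_{F,i}\,x|\le\mathrm{bd}_F$; $(x,y)\in\mathrm{rel}_F\,\vec R$ iff some $z$ has $\mathrm{set}_{F,i}\,z\subseteq R_i$ for all $i$, $\mathrm{map}_F\,\overrightarrow{\mathrm{fst}}\,z=x$, $\mathrm{map}_F\,\overrightarrow{\mathrm{snd}}\,z=y$; $\mathrm{rel}_F\,\vec R\bullet\mathrm{rel}_F\,\vec S\subseteq\mathrm{rel}_F\,\overrightarrow{(R\bullet S)}$. A relation $\rightsquigarrow$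 is confluent if whenever $x\overset{*}{\rightsquigarrow}y$ and $x\overset{*}{\rightsquigarrow}z$ there is $u$ with $y\overset{*}{\rightsquigarrow}u$ and $z\overset{*}{\rightsquigarrow}u$, where $\overset{*}{\rightsquigarrow}$ is the reflexive–transitive closure. In (ii), $x$ ranges over $F$ applied to pair types, $\mathrm{map}_F\,\overrightarrow{\mathrm{fst}}\,x$ projects to the first components, and $\sim$ is used at the pair type. -}

module Defs where

open import Data.Nat using (ℕ)
open import Data.Fin using (Fin)
open import Data.Product using (Σ; ∃; ∃-syntax; _×_; _,_; proj₁; proj₂)
open import Function using (id; _∘_)
open import Function.Bundles using (_↣_)
open import Relation.Binary.PropositionalEquality using (_≡_)
open import Relation.Binary.Construct.Closure.ReflexiveTransitive using (Star)

_•_ : {A B C : Set} → (A → B → Set) → (B → C → Set) → (A → C → Set)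
(R • S) a c = ∃[ b ] (R a b × S b c)

_⊆ᵣ_ : {A B : Set} → (A → B → Set) → (A → B → Set) → Set
R ⊆ᵣ S = ∀ a b → R a b → S a b

_⊗_ : {n : ℕ} → (Fin n → Set) → (Fin n → Set) → (Fin n → Set)
(A ⊗ B) i = A i × B i

Confluent : {A : Set} → (A → A → Set) → Set
Confluent {A} _⇝_ =
  ∀ x y z → Star _⇝_ x y → Star _⇝_ x z →
  ∃[ u ] (Star _⇝_ y u × Star _⇝_ z u)

-- n-ary bounded natural functor.  Setters are predicates (sets) on the
-- component types; equalities of sets are stated as mutual inclusion and
-- equalities of functions pointwise.
record BNF (n : ℕ) : Set₁ where
  field
    F     : (Fin n → Set) → Set
    map   : {A B : Fin n → Set} → ((i : Fin n) → A i → B i) → F A → F B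
    set   : {A : Fin n → Set} → (i : Fin n) → F A → A i → Set
    bd    : Set
    rel   : {A B : Fin n → Set} → ((i : Fin n) → A i → B i → Set) → F A → F B → Set

    map-id   : {A : Fin n → Set} (x : F A) → map (λ i → id) x ≡ x
    map-comp : {A B C : Fin n → Set} (f : (i : Fin n) → A i → B i)
               (g : (i : Fin n) → B i → C i) (x : F A) →
               map g (map f x) ≡ map (λ i → g i ∘ f i) x
    set-map-⊆ : {A B : Fin n → Set} (f : (i : Fin n) → A i → B i) (x : F A)
                (i : Fin n) (z : B i) →
                set i (map f x) z → ∃[ w ] (set i x w × f i w ≡ z)
    set-map-⊇ : {A B : Fin n → Set} (f : (i : Fin n) → A i → B i) (x : F A)
                (i : Fin n) (w : A i) →
                set i x w → set i (map f x) (f i w)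
    map-cong : {A B : Fin n → Set} (f g : (i : Fin n) → A i → B i) (x : F A) →
               ((i : Fin n) (z : A i) → set i x z → f i z ≡ g i z) →
               map f x ≡ map g x
    bd-infinite : ℕ ↣ bd
    set-bd : {A : Fin n → Set} (i : Fin n) (x : F A) → Σ (A i) (set i x) ↣ bd
    rel-char⇒ : {A B : Fin n → Set} (R : (i : Fin n) → A i → B i → Set)
                (x : F A) (y : F B) → rel R x y →
                ∃[ z ] (((i : Fin n) (p : A i × B i) → set i z p → R i (proj₁ p) (proj₂ p))
                        × map (λ i → proj₁) z ≡ x × map (λ i → proj₂) z ≡ y)
    rel-char⇐ : {A B : Fin n → Set} (R : (i : Fin n) → A i → B i → Set)
                (x : F A) (y : F B) (z : F (A ⊗ B)) →
                ((i : Fin n) (p : A i × B i) → set i z p → R i (proj₁ p) (proj₂ p)) →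
                map (λ i → proj₁) z ≡ x → map (λ i → proj₂) z ≡ y → rel R x y
    rel-comp : {A B C : Fin n → Set} (R : (i : Fin n) → A i → B i → Set)
               (S : (i : Fin n) → B i → C i → Set) →
               (rel R • rel S) ⊆ᵣ rel (λ i → R i • S i)

{-# OPTIONS --safe #-}
module Submission where

open import Defs
open import Data.Nat using (ℕ)
open import Data.Fin using (Fin)
open import Data.Product using (∃-syntax; _×_; _,_; proj₁; proj₂)
open import Function using (_∘_)
open import Level using (0ℓ)
open import Relation.Binary.Core using (Rel)
open import Relation.Binary.Definitions using (Reflexive; Transitive)
open import Relation.Binary.PropositionalEquality using (_≡_; refl; sym)
open import Relation.Binary.Construct.Closure.ReflexiveTransitive using (Star; ε; _◅_; _◅◅_)
open import Relation.Binary.Construct.Closure.Symmetric using (fwd; bwd)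
open import Relation.Binary.Structures using (IsEquivalence)
open import Relation.Binary.Construct.Closure.Equivalence using (EqClosure)

-- Let x rel R y ∼ y′ rel S z. By confluence y and y′ have a common reduct u.
-- Hypothesis (ii), iterated along y ⇝* u, moves a witness w of x rel R y to
-- some w′ ∼ w whose second projection is u and whose elements are among those
-- of w; hence x ∼ map fst w′ rel R u. Dually u rel S z′ ∼ z, and
-- rel R • rel S ⊆ rel (R • S) joins the two at u.

Joinable : {X : Set} → Rel X 0ℓ → Rel X 0ℓ
Joinable _⇝_ x y = ∃[ u ] (Star _⇝_ x u × Star _⇝_ y u)

confluent⇒eqClosure⊆joinable : {X : Set} {_⇝_ : Rel X 0ℓ} →
  Confluent _⇝_ → EqClosure _⇝_ ⊆ᵣ Joinable _⇝_
confluent⇒eqClosure⊆joinable conf x .x ε = x , ε , ε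
confluent⇒eqClosure⊆joinable conf x y (fwd x⇝w ◅ w↭y)
  with confluent⇒eqClosure⊆joinable conf _ y w↭y
... | u , w⇝*u , y⇝*u = u , x⇝w ◅ w⇝*u , y⇝*u
confluent⇒eqClosure⊆joinable conf x y (bwd w⇝x ◅ w↭y)
  with confluent⇒eqClosure⊆joinable conf _ y w↭y
... | u , w⇝*u , y⇝*u with conf _ x u (w⇝x ◅ ε) w⇝*u
... | v , x⇝*v , u⇝*v = v , x⇝*v , y⇝*u ◅◅ u⇝*v

star-lift : {X Y : Set} {_⇝_ : Rel Y 0ℓ} {_≼_ : Rel X 0ℓ} (π : X → Y) →
  Reflexive _≼_ → Transitive _≼_ →
  (∀ x y → π x ⇝ y → ∃[ x′ ] (y ≡ π x′ × x ≼ x′)) →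
  ∀ x y → Star _⇝_ (π x) y → ∃[ x′ ] (y ≡ π x′ × x ≼ x′)
star-lift π ≼-refl ≼-trans lift x _ ε = x , refl , ≼-refl
star-lift π ≼-refl ≼-trans lift x y (πx⇝v ◅ v⇝*y) with lift x _ πx⇝v
... | x₁ , refl , x≼x₁ with star-lift π ≼-refl ≼-trans lift x₁ y v⇝*y
... | x₂ , y≡πx₂ , x₁≼x₂ = x₂ , y≡πx₂ , ≼-trans x≼x₁ x₁≼x₂

module _ {n : ℕ} (B : BNF n) where

  open BNF B

  module Reduction
    (_∼_ : {A : Fin n → Set} → F A → F A → Set)
    (∼-isEquivalence : {A : Fin n → Set} → IsEquivalence (_∼_ {A}))
    (map-resp-∼ : {A C : Fin n → Set} (f : (i : Fin n) → A i → C i) (x y : F A) →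
      x ∼ y → map f x ∼ map f y)
    (_⇝_ : {A : Fin n → Set} → F A → F A → Set)
    (lift-fst : {A C : Fin n → Set} (x : F (A ⊗ C)) (y : F A) →
      map (λ i → proj₁) x ⇝ y →
      ∃[ y′ ] (y ≡ map (λ i → proj₁) y′ × x ∼ y′ ×
               ((i : Fin n) (p : A i × C i) → set i y′ p → set i x p)))
    (lift-snd : {A C : Fin n → Set} (x : F (A ⊗ C)) (y : F C) →
      map (λ i → proj₂) x ⇝ y →
      ∃[ y′ ] (y ≡ map (λ i → proj₂) y′ × x ∼ y′ ×
               ((i : Fin n) (p : A i × C i) → set i y′ p → set i x p)))
    where

    private
      module ∼ {A : Fin n → Set} = IsEquivalence (∼-isEquivalence {A})

    _≼_ : {A : Fin n → Set} → Rel (F A) 0ℓ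
    x ≼ x′ = x ∼ x′ × (∀ i p → set i x′ p → set i x p)

    ≼-refl : {A : Fin n → Set} → Reflexive (_≼_ {A})
    ≼-refl = ∼.refl , λ i p z∈x → z∈x

    ≼-trans : {A : Fin n → Set} → Transitive (_≼_ {A})
    ≼-trans (x∼y , y⊆x) (y∼z , z⊆y) = ∼.trans x∼y y∼z , λ i p → y⊆x i p ∘ z⊆y i p

    witness-reduceʳ : {A C : Fin n → Set} (x : F (A ⊗ C)) (u : F C) →
      Star _⇝_ (map (λ i → proj₂) x) u → ∃[ x′ ] (u ≡ map (λ i → proj₂) x′ × x ≼ x′)
    witness-reduceʳ = star-lift (map (λ i → proj₂)) ≼-refl ≼-trans lift-snd

    witness-reduceˡ : {A C : Fin n → Set} (x : F (A ⊗ C)) (u : F A) →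
      Star _⇝_ (map (λ i → proj₁) x) u → ∃[ x′ ] (u ≡ map (λ i → proj₁) x′ × x ≼ x′)
    witness-reduceˡ = star-lift (map (λ i → proj₁)) ≼-refl ≼-trans lift-fst

    rel-reduceʳ : {A C : Fin n → Set} (R : (i : Fin n) → A i → C i → Set) (x : F A) (y u : F C) →
      rel R x y → Star _⇝_ y u → (_∼_ • rel R) x u
    rel-reduceʳ R x y u xRy y⇝*u with rel-char⇒ R x y xRy
    ... | z , z⊆R , refl , refl with witness-reduceʳ z u y⇝*u
    ... | z′ , u≡snd , z∼z′ , z′⊆z =
      map (λ i → proj₁) z′ ,
      map-resp-∼ (λ i → proj₁) z z′ z∼z′ ,
      rel-char⇐ R _ u z′ (λ i p → z⊆R i p ∘ z′⊆z i p) refl (sym u≡snd)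

    rel-reduceˡ : {A C : Fin n → Set} (S : (i : Fin n) → A i → C i → Set) (y u : F A) (z : F C) →
      rel S y z → Star _⇝_ y u → (rel S • _∼_) u z
    rel-reduceˡ S y u z ySz y⇝*u with rel-char⇒ S y z ySz
    ... | w , w⊆S , refl , refl with witness-reduceˡ w u y⇝*u
    ... | w′ , u≡fst , w∼w′ , w′⊆w =
      map (λ i → proj₂) w′ ,
      rel-char⇐ S u _ w′ (λ i p → w⊆S i p ∘ w′⊆w i p) (sym u≡fst) refl ,
      ∼.sym (map-resp-∼ (λ i → proj₂) w w′ w∼w′)

    rel•∼•rel⊆∼•rel•∼ : ({A : Fin n → Set} → Confluent (_⇝_ {A})) →
      ({A : Fin n → Set} → _∼_ {A} ⊆ᵣ EqClosure (_⇝_ {A})) →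
      {A B′ C : Fin n → Set} (R : (i : Fin n) → A i → B′ i → Set) (S : (i : Fin n) → B′ i → C i → Set) →
      ((rel R • _∼_) • rel S) ⊆ᵣ ((_∼_ • rel (λ i → R i • S i)) • _∼_)
    rel•∼•rel⊆∼•rel•∼ confluent ∼⊆↭ R S x z (y′ , (y , xRy , y∼y′) , y′Sz)
      with confluent⇒eqClosure⊆joinable confluent y y′ (∼⊆↭ y y′ y∼y′)
    ... | u , y⇝*u , y′⇝*u
      with rel-reduceʳ R x y u xRy y⇝*u | rel-reduceˡ S y′ u z y′Sz y′⇝*u
    ... | x′ , x∼x′ , x′Ru | z′ , uSz′ , z′∼z =
      z′ , (x′ , x∼x′ , rel-comp R S x′ z′ (u , x′Ru , uSz′)) , z′∼z

-- The hypothesis that each R i • S i is nonempty is unused: witnesses of rel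
-- live in F (A ⊗ B′) itself, so no HOL type of related pairs (which would have
-- to be nonempty) is ever formed.
theorem3p21 : (n : ℕ) (B : BNF n) →
    let open BNF B in
    (_∼_ : {A : Fin n → Set} → F A → F A → Set) →
    ({A : Fin n → Set} → IsEquivalence (_∼_ {A})) →
    ({A C : Fin n → Set} (f : (i : Fin n) → A i → C i) (x y : F A) →
       x ∼ y → map f x ∼ map f y) →
    (_⇝_ : {A : Fin n → Set} → F A → F A → Set) →
    ({A : Fin n → Set} → Confluent (_⇝_ {A})) →
    ({A : Fin n → Set} → _∼_ {A} ⊆ᵣ EqClosure (_⇝_ {A})) →
    ({A C : Fin n → Set} (x : F (A ⊗ C)) (y : F A) →
       map (λ i → proj₁) x ⇝ y →
       ∃[ y′ ] (y ≡ map (λ i → proj₁) y′ × x ∼ y′ ×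
                ((i : Fin n) (p : A i × C i) → set i y′ p → set i x p))) →
    ({A C : Fin n → Set} (x : F (A ⊗ C)) (y : F C) →
       map (λ i → proj₂) x ⇝ y →
       ∃[ y′ ] (y ≡ map (λ i → proj₂) y′ × x ∼ y′ ×
                ((i : Fin n) (p : A i × C i) → set i y′ p → set i x p))) →
    {A B′ C : Fin n → Set}
    (R : (i : Fin n) → A i → B′ i → Set) (S : (i : Fin n) → B′ i → C i → Set) →
    ((i : Fin n) → ∃[ a ] ∃[ c ] (R i • S i) a c) →
    ((rel R • _∼_) • rel S) ⊆ᵣ ((_∼_ • rel (λ i → R i • S i)) • _∼_)
theorem3p21 n B _∼_ ∼-isEquivalence map-resp-∼ _⇝_ confluent ∼⊆↭ lift-fst lift-snd R S _ =
  Reduction.rel•∼•rel⊆∼•rel•∼ B _∼_ ∼-isEquivalence map-resp-∼ _⇝_ lift-fst lift-snd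
    confluent ∼⊆↭ R S
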